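{- For every $m\ge 0$, $D^{sc}_f(Q_{m+2};Q_m)=m+2$.
   Context: The $n$-dimensional hypercube $Q_n$ is the graph whose vertices are the binary strings of length $n$, two vertices being adjacent iff they differ in exactly one position; $Q_0$ is a single vertex. The diameter of a graph is the maximum graph distance between two of its vertices. For $0\le k\le n$, a $k$-subcube of $Q_n$ is a vertex set $U\subseteq V(Q_n)$ whose induced subgraph is isomorphic to $Q_k$. The $Q_m$-subcube connectivity $\kappa^{sc}(Q_n;Q_m)$ is the minimum number of pairwise disjoint vertex sets, each a $k$-subcube of $Q_n$ for some $0\le k\le m$, whose deletion disconnects $Q_n$. The $Q_m$-subcube fault diameter $D^{sc}_f(Q_n;Q_m)$ is the maximum diameter of $Q_n-\bigcup\mathcal{F}$ over all families $\mathcal{F}$ of at most $\kappa^{sc}(Q_n;Q_m)-1$ pairwise disjoint vertex sets, each a $k$-subcube of $Q_n$ for some $0\le k\le m$. -}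

module Defs where

open import Data.Nat using (ℕ; zero; suc; _+_; _≤_; _<_)
open import Data.Bool using (Bool; true; false; if_then_else_)
open import Data.Vec using (Vec; []; _∷_)
open import Data.Fin using (Fin)
open import Data.Product using (Σ; ∃; _×_; _,_)
open import Data.Empty using (⊥)
open import Relation.Nullary using (¬_)
open import Relation.Binary.PropositionalEquality using (_≡_; _≢_)
open import Function.Definitions using (Injective)
open import Function.Bundles using (_⇔_)

Vertex : ℕ → Set
Vertex n = Vec Bool n

hamming : ∀ {n} → Vertex n → Vertex n → ℕ
hamming []       []       = 0
hamming (x ∷ xs) (y ∷ ys) = (if x Data.Bool.xor y then 1 else 0) + hamming xs ys

Adj : ∀ {n} → Vertex n → Vertex n → Set
Adj u v = hamming u v ≡ 1

-- A k-subcube of Q_n (k ≤ m): a vertex set U (the image of f) together with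
-- an isomorphism f from Q_k onto the induced subgraph Q_n[U]
-- (f injective, and f x, f y adjacent iff x, y adjacent).
record Subcube (n m : ℕ) : Set where
  field
    dim    : ℕ
    dim≤m  : dim ≤ m
    emb    : Vertex dim → Vertex n
    inj    : Injective _≡_ _≡_ emb
    adjIff : ∀ x y → Adj (emb x) (emb y) ⇔ Adj x y

open Subcube public

_∈C_ : ∀ {n m} → Vertex n → Subcube n m → Set
v ∈C C = ∃ λ x → emb C x ≡ v

record Family (n m t : ℕ) : Set where
  field
    cube     : Fin t → Subcube n m
    disjoint : ∀ i j → i ≢ j → ∀ v → v ∈C cube i → v ∈C cube j → ⊥

open Family public

Deleted : ∀ {n m t} → Family n m t → Vertex n → Set
Deleted F v = ∃ λ i → v ∈C cube F i

Alive : ∀ {n m t} → Family n m t → Vertex n → Set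
Alive F v = ¬ Deleted F v

data Path {n m t} (F : Family n m t) : Vertex n → Vertex n → ℕ → Set where
  here : ∀ {u} → Alive F u → Path F u u 0
  step : ∀ {u w v l} → Alive F u → Adj u w → Path F w v l → Path F u v (suc l)

Disconnects : ∀ {n m t} → Family n m t → Set
Disconnects F = ∃ λ u → ∃ λ v → Alive F u × Alive F v × (∀ l → ¬ Path F u v l)

IsSubcubeConnectivity : ℕ → ℕ → ℕ → Set
IsSubcubeConnectivity n m κ =
  (Σ (Family n m κ) Disconnects) ×
  (∀ t → t < κ → (F : Family n m t) → ¬ Disconnects F)

DistIs : ∀ {n m t} → Family n m t → Vertex n → Vertex n → ℕ → Set
DistIs F u v d = Path F u v d × (∀ l → l < d → ¬ Path F u v l)

-- D^sc_f(Q_n; Q_m) = d, given κ = κ^sc(Q_n; Q_m): the maximum, over all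
-- families of at most κ - 1 (i.e. fewer than κ) disjoint subcubes, of the
-- diameter of Q_n - ⋃ F equals d.
FaultDiameterIs : ℕ → ℕ → ℕ → ℕ → Set
FaultDiameterIs n m κ d =
  (∀ t → t < κ → (F : Family n m t) → ∀ u v → Alive F u → Alive F v →
     ∃ λ l → l ≤ d × Path F u v l) ×
  (Σ ℕ λ t → t < κ × Σ (Family n m t) λ F →
     ∃ λ u → ∃ λ v → Alive F u × Alive F v × DistIs F u v d)

{-# OPTIONS --safe #-}
-- A k-subcube is the image of an injective graph homomorphism Q_k → Q_n, and such an image is
-- constant outside at most k coordinates: by induction on k, the two layers of Q_(k+1) are
-- joined by a matching whose image edges all point in one direction, because opposite sides
-- of a 4-cycle of Q_n are parallel. Hence fewer than two faulty subcubes of dimension ≤ m in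
-- Q_(m+2) miss two half-cubes {w | lookup w p ≡ α} and {w | lookup w q ≡ β} with p ≢ q. Two
-- survivors u, v are joined through one of them by a geodesic inside it, preceded or followed
-- by one step into it, of total length hamming u v; if u and v lie outside both half-cubes, a
-- step in and a step out are needed, but then u and v agree at p and q, so that
-- hamming u v + 2 ≤ m + 2. Conversely, deleting the subcubes 00∗ and 11∗ leaves 01∗ and 10∗
-- with no edge between them, and without faults antipodal vertices are at distance m + 2.
module Submission where

open import Defs
open import Data.Nat using (ℕ; zero; suc; _+_; _≤_; _<_; z≤n; s≤s)
open import Data.Nat.Properties
  using (≤-refl; ≤-trans; ≤-reflexive; +-suc; +-comm; +-mono-≤; +-monoʳ-≤; m≤n⇒m≤1+n; n≤1+n;
         suc-injective; ≤⇒≯; module ≤-Reasoning)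
open import Data.Bool using (Bool; true; false; not; _xor_; if_then_else_)
open import Data.Bool.Properties using (xor-same; xor-comm; not-involutive; ¬-not; not-¬)
import Data.Bool.Properties as Bool
open import Data.Fin using (Fin; zero; suc)
import Data.Fin.Properties as Fin
open import Data.Fin.Subset using (Subset; inside; outside; _∉_; _∪_; ⁅_⁆; ∣_∣) renaming (⊥ to ∅)
open import Data.Fin.Subset.Properties
  using (drop-there; ∣p∣≤∣x∷p∣; ∣⁅x⁆∣≡1; ∣⊥∣≡0; p⊆p∪q; q⊆p∪q; x∉⁅y⁆⇒x≢y)
open import Data.Vec using ([]; _∷_; _++_; lookup; updateAt; replicate; head; tail)
open import Data.Vec.Properties
  using (lookup∘updateAt; lookup∘updateAt′; updateAt-updateAt-local; updateAt-id;
         ++-injectiveʳ; ∷-injectiveʳ)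
open import Data.Product using (Σ; ∃; ∃₂; _×_; _,_; map)
open import Data.Empty using (⊥; ⊥-elim)
open import Data.Sum using (_⊎_; inj₁; inj₂; [_,_])
open import Relation.Nullary using (¬_; yes; no; contradiction)
open import Relation.Nullary.Decidable using (_⊎-dec_)
open import Relation.Binary.PropositionalEquality
  using (_≡_; _≢_; refl; sym; trans; cong; cong₂; subst; ≢-sym; module ≡-Reasoning)
open import Function using (_∘_; id)
open import Function.Definitions using (Injective)
open import Function.Bundles using (mk⇔; Equivalence)

flip : ∀ {n} → Fin n → Vertex n → Vertex n
flip i v = updateAt v i not

lookup-flip-≢ : ∀ {n} {i : Fin n} {b} (v : Vertex n) → lookup v i ≢ b → lookup (flip i v) i ≡ b
lookup-flip-≢ {i = i} v ne = trans (lookup∘updateAt i v) (sym (¬-not (≢-sym ne)))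

flip-involutive : ∀ {n} (i : Fin n) (v : Vertex n) → flip i (flip i v) ≡ v
flip-involutive i v = trans (updateAt-updateAt-local i v (not-involutive _)) (updateAt-id i v)

hamming-refl : ∀ {n} (v : Vertex n) → hamming v v ≡ 0
hamming-refl []       = refl
hamming-refl (x ∷ v) rewrite xor-same x = hamming-refl v

hamming-comm : ∀ {n} (u v : Vertex n) → hamming u v ≡ hamming v u
hamming-comm []      []      = refl
hamming-comm (x ∷ u) (y ∷ v) =
  cong₂ (λ b h → (if b then 1 else 0) + h) (xor-comm x y) (hamming-comm u v)

hamming≡0⇒≡ : ∀ {n} (u v : Vertex n) → hamming u v ≡ 0 → u ≡ v
hamming≡0⇒≡ []          []          _  = refl
hamming≡0⇒≡ (true  ∷ u) (true  ∷ v) eq = cong (true ∷_) (hamming≡0⇒≡ u v eq)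
hamming≡0⇒≡ (false ∷ u) (false ∷ v) eq = cong (false ∷_) (hamming≡0⇒≡ u v eq)

hamming≤n : ∀ {n} (u v : Vertex n) → hamming u v ≤ n
hamming≤n []      []      = z≤n
hamming≤n (x ∷ u) (y ∷ v) = +-mono-≤ (bit≤1 (x xor y)) (hamming≤n u v)
  where
  bit≤1 : ∀ b → (if b then 1 else 0) ≤ 1
  bit≤1 true  = ≤-refl
  bit≤1 false = z≤n

hamming-suc⇒differ : ∀ {n d} (u v : Vertex n) → hamming u v ≡ suc d →
                     ∃ λ i → lookup u i ≢ lookup v i
hamming-suc⇒differ []          []          ()
hamming-suc⇒differ (true  ∷ u) (true  ∷ v) eq = map suc id (hamming-suc⇒differ u v eq)
hamming-suc⇒differ (false ∷ u) (false ∷ v) eq = map suc id (hamming-suc⇒differ u v eq)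
hamming-suc⇒differ (true  ∷ u) (false ∷ v) _  = zero , λ ()
hamming-suc⇒differ (false ∷ u) (true  ∷ v) _  = zero , λ ()

hamming-flip-differ : ∀ {n} (i : Fin n) (u v : Vertex n) → lookup u i ≢ lookup v i →
                      suc (hamming (flip i u) v) ≡ hamming u v
hamming-flip-differ zero    (true  ∷ u) (false ∷ v) _  = refl
hamming-flip-differ zero    (false ∷ u) (true  ∷ v) _  = refl
hamming-flip-differ zero    (true  ∷ u) (true  ∷ v) ne = ⊥-elim (ne refl)
hamming-flip-differ zero    (false ∷ u) (false ∷ v) ne = ⊥-elim (ne refl)
hamming-flip-differ (suc i) (x ∷ u)     (y ∷ v)     ne =
  trans (sym (+-suc _ _)) (cong (_ +_) (hamming-flip-differ i u v ne))

hamming-flip-agree : ∀ {n} (i : Fin n) (u v : Vertex n) → lookup u i ≡ lookup v i →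
                     hamming (flip i u) v ≡ suc (hamming u v)
hamming-flip-agree zero    (true  ∷ u) (true  ∷ v) _  = refl
hamming-flip-agree zero    (false ∷ u) (false ∷ v) _  = refl
hamming-flip-agree (suc i) (x ∷ u)     (y ∷ v)     eq =
  trans (cong (_ +_) (hamming-flip-agree i u v eq)) (+-suc _ _)

hamming≤1+hamming-flip : ∀ {n} (i : Fin n) (u v : Vertex n) →
                         hamming u v ≤ suc (hamming (flip i u) v)
hamming≤1+hamming-flip i u v with lookup u i Bool.≟ lookup v i
... | yes eq rewrite hamming-flip-agree i u v eq = m≤n⇒m≤1+n (n≤1+n _)
... | no ne  = ≤-reflexive (sym (hamming-flip-differ i u v ne))

agree-at-two⇒2+hamming≤n : ∀ {n} {p q : Fin n} (u v : Vertex n) → p ≢ q →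
                       lookup u p ≡ lookup v p → lookup u q ≡ lookup v q → 2 + hamming u v ≤ n
agree-at-two⇒2+hamming≤n {p = p} {q} u v p≢q up uq = begin
  2 + hamming u v                ≡⟨ cong suc (sym (hamming-flip-agree p u v up)) ⟩
  suc (hamming (flip p u) v)     ≡⟨ sym (hamming-flip-agree q (flip p u) v uq′) ⟩
  hamming (flip q (flip p u)) v  ≤⟨ hamming≤n (flip q (flip p u)) v ⟩
  _                              ∎
  where
  open ≤-Reasoning
  uq′ : lookup (flip p u) q ≡ lookup v q
  uq′ = trans (lookup∘updateAt′ q p (≢-sym p≢q) u) uq

Adj-flip : ∀ {n} (v : Vertex n) (i : Fin n) → Adj v (flip i v)
Adj-flip v i = begin
  hamming v (flip i v)  ≡⟨ hamming-comm v (flip i v) ⟩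
  hamming (flip i v) v  ≡⟨ hamming-flip-agree i v v refl ⟩
  suc (hamming v v)     ≡⟨ cong suc (hamming-refl v) ⟩
  1                     ∎
  where open ≡-Reasoning

Adj-sym : ∀ {n} (u v : Vertex n) → Adj u v → Adj v u
Adj-sym u v adj = trans (hamming-comm v u) adj

Adj⇒flip : ∀ {n} (u v : Vertex n) → Adj u v → ∃ λ i → v ≡ flip i u
Adj⇒flip u v adj with hamming-suc⇒differ u v adj
... | i , ne = i , sym (hamming≡0⇒≡ _ _ (suc-injective (trans (hamming-flip-differ i u v ne) adj)))

∣p∪q∣≤∣p∣+∣q∣ : ∀ {n} (p q : Subset n) → ∣ p ∪ q ∣ ≤ ∣ p ∣ + ∣ q ∣
∣p∪q∣≤∣p∣+∣q∣ []            []            = z≤n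
∣p∪q∣≤∣p∣+∣q∣ (outside ∷ p) (outside ∷ q) = ∣p∪q∣≤∣p∣+∣q∣ p q
∣p∪q∣≤∣p∣+∣q∣ (outside ∷ p) (inside  ∷ q) =
  ≤-trans (s≤s (∣p∪q∣≤∣p∣+∣q∣ p q)) (≤-reflexive (sym (+-suc ∣ p ∣ ∣ q ∣)))
∣p∪q∣≤∣p∣+∣q∣ (inside  ∷ p) (s       ∷ q) =
  s≤s (≤-trans (∣p∪q∣≤∣p∣+∣q∣ p q) (+-monoʳ-≤ ∣ p ∣ (∣p∣≤∣x∷p∣ s q)))

∣⁅x⁆∪p∣≤1+∣p∣ : ∀ {n} (x : Fin n) (p : Subset n) → ∣ ⁅ x ⁆ ∪ p ∣ ≤ suc ∣ p ∣
∣⁅x⁆∪p∣≤1+∣p∣ x p = subst (λ k → ∣ ⁅ x ⁆ ∪ p ∣ ≤ k + ∣ p ∣) (∣⁅x⁆∣≡1 x) (∣p∪q∣≤∣p∣+∣q∣ ⁅ x ⁆ p)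

∣p∣<n⇒∃∉ : ∀ {n} (p : Subset n) → ∣ p ∣ < n → ∃ λ x → x ∉ p
∣p∣<n⇒∃∉ (outside ∷ p) _        = zero , λ ()
∣p∣<n⇒∃∉ (inside  ∷ p) (s≤s lt) = map suc (_∘ drop-there) (∣p∣<n⇒∃∉ p lt)

2+∣p∣≤n⇒∃₂∉ : ∀ {n} (p : Subset n) → 2 + ∣ p ∣ ≤ n → ∃₂ λ x y → x ≢ y × x ∉ p × y ∉ p
2+∣p∣≤n⇒∃₂∉ p le with ∣p∣<n⇒∃∉ p (≤-trans (n≤1+n _) le)
... | x , x∉p with ∣p∣<n⇒∃∉ (⁅ x ⁆ ∪ p) (≤-trans (s≤s (∣⁅x⁆∪p∣≤1+∣p∣ x p)) le)
... | y , y∉x∪p = x , y , ≢-sym (x∉⁅y⁆⇒x≢y (y∉x∪p ∘ p⊆p∪q p)) , x∉p , y∉x∪p ∘ q⊆p∪q ⁅ x ⁆ p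

flip-induction : ∀ {k} (P : Vertex k → Set) → P (replicate k false) →
                 (∀ y i → P y → P (flip i y)) → ∀ y → P y
flip-induction P p₀ closed []      = p₀
flip-induction P p₀ closed (b ∷ y) =
  from-false b (flip-induction (P ∘ (false ∷_)) p₀ (λ y i → closed (false ∷ y) (suc i)) y)
  where
  from-false : ∀ b → P (false ∷ y) → P (b ∷ y)
  from-false false p = p
  from-false true  p = closed (false ∷ y) zero p

square-opposite-directions : ∀ {n} (w : Vertex n) {c d d′ e : Fin n} → c ≢ d → c ≢ d′ →
                             flip d′ (flip c w) ≡ flip e (flip d w) → d′ ≡ d
square-opposite-directions w {c} {d} {d′} {e} c≢d c≢d′ square with d′ Fin.≟ d
... | yes d′≡d = d′≡d
... | no d′≢d with e Fin.≟ c
...   | no e≢c = ⊥-elim (not-¬ refl (begin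
        lookup w c                      ≡⟨ lookup∘updateAt′ c d c≢d w ⟨
        lookup (flip d w) c             ≡⟨ lookup∘updateAt′ c e (≢-sym e≢c) (flip d w) ⟨
        lookup (flip e (flip d w)) c    ≡⟨ cong (λ v → lookup v c) square ⟨
        lookup (flip d′ (flip c w)) c   ≡⟨ lookup∘updateAt′ c d′ c≢d′ (flip c w) ⟩
        lookup (flip c w) c             ≡⟨ lookup∘updateAt c w ⟩
        not (lookup w c)                ∎))
  where open ≡-Reasoning
...   | yes refl = ⊥-elim (not-¬ refl (begin
        lookup w d                      ≡⟨ lookup∘updateAt′ d c (≢-sym c≢d) w ⟨
        lookup (flip c w) d             ≡⟨ lookup∘updateAt′ d d′ (≢-sym d′≢d) (flip c w) ⟨
        lookup (flip d′ (flip c w)) d   ≡⟨ cong (λ v → lookup v d) square ⟩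
        lookup (flip c (flip d w)) d    ≡⟨ lookup∘updateAt′ d c (≢-sym c≢d) (flip d w) ⟩
        lookup (flip d w) d             ≡⟨ lookup∘updateAt d w ⟩
        not (lookup w d)                ∎))
  where open ≡-Reasoning

ConstantOutside : ∀ {k n} → (Vertex k → Vertex n) → Subset n → Set
ConstantOutside f M = ∀ x y {i} → i ∉ M → lookup (f x) i ≡ lookup (f y) i

module Layers {k n} (f : Vertex (suc k) → Vertex n) (f-injective : Injective _≡_ _≡_ f)
              (f-adj : ∀ x y → Adj x y → Adj (f x) (f y)) where

  f₀ f₁ : Vertex k → Vertex n
  f₀ y = f (false ∷ y)
  f₁ y = f (true ∷ y)

  f₀-injective : Injective _≡_ _≡_ f₀
  f₀-injective eq = ∷-injectiveʳ (f-injective eq)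

  f₀-adj : ∀ x y → Adj x y → Adj (f₀ x) (f₀ y)
  f₀-adj x y = f-adj (false ∷ x) (false ∷ y)

  layers-disjoint : ∀ y y′ → f₀ y ≢ f₁ y′
  layers-disjoint y y′ eq with f-injective eq
  ... | ()

  edge : ∀ b y i → ∃ λ c → f (b ∷ flip i y) ≡ flip c (f (b ∷ y))
  edge b y i = Adj⇒flip _ _ (f-adj (b ∷ y) (b ∷ flip i y) (Adj-flip (b ∷ y) (suc i)))

  rung : ∀ y → ∃ λ d → f₁ y ≡ flip d (f₀ y)
  rung y = Adj⇒flip _ _ (f-adj (false ∷ y) (true ∷ y) (Adj-flip (false ∷ y) zero))

  rung-direction-stable : ∀ {d} y i → f₁ y ≡ flip d (f₀ y) → f₁ (flip i y) ≡ flip d (f₀ (flip i y))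
  rung-direction-stable {d} y i r with edge false y i | rung (flip i y) | edge true y i
  ... | c , e₀ | d′ , r′ | e , e₁ = subst (λ d → f₁ (flip i y) ≡ flip d (f₀ (flip i y))) d′≡d r′
    where
    c≢d : c ≢ d
    c≢d refl = layers-disjoint (flip i y) y (trans e₀ (sym r))
    c≢d′ : c ≢ d′
    c≢d′ refl = layers-disjoint y (flip i y)
                  (sym (trans r′ (trans (cong (flip c) e₀) (flip-involutive c (f₀ y)))))
    d′≡d : d′ ≡ d
    d′≡d = square-opposite-directions (f₀ y) c≢d c≢d′ (begin
      flip d′ (flip c (f₀ y))  ≡⟨ cong (flip d′) e₀ ⟨
      flip d′ (f₀ (flip i y))  ≡⟨ r′ ⟨
      f₁ (flip i y)            ≡⟨ e₁ ⟩
      flip e (f₁ y)            ≡⟨ cong (flip e) r ⟩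
      flip e (flip d (f₀ y))   ∎)
      where open ≡-Reasoning

  rung-direction-constant : ∃ λ d → ∀ y → f₁ y ≡ flip d (f₀ y)
  rung-direction-constant with rung (replicate k false)
  ... | d , r = d , flip-induction _ r rung-direction-stable

  constant-outside-∪ : ∀ {d M₀} → (∀ y → f₁ y ≡ flip d (f₀ y)) → ConstantOutside f₀ M₀ →
                       ConstantOutside f (⁅ d ⁆ ∪ M₀)
  constant-outside-∪ {d} {M₀} rungs f₀-constant x y {i} i∉M = begin
    lookup (f x) i             ≡⟨ via-f₀ x ⟩
    lookup (f₀ (tail x)) i     ≡⟨ f₀-constant (tail x) (tail y) (i∉M ∘ q⊆p∪q ⁅ d ⁆ M₀) ⟩
    lookup (f₀ (tail y)) i     ≡⟨ via-f₀ y ⟨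
    lookup (f y) i             ∎
    where
    open ≡-Reasoning
    via-f₀ : ∀ x → lookup (f x) i ≡ lookup (f₀ (tail x)) i
    via-f₀ (false ∷ x) = refl
    via-f₀ (true  ∷ x) = trans (cong (λ v → lookup v i) (rungs x))
                               (lookup∘updateAt′ i d (x∉⁅y⁆⇒x≢y (i∉M ∘ p⊆p∪q M₀)) (f₀ x))

embedding-constant-outside : ∀ k {n} (f : Vertex k → Vertex n) → Injective _≡_ _≡_ f →
                             (∀ x y → Adj x y → Adj (f x) (f y)) →
                             ∃ λ M → ∣ M ∣ ≤ k × ConstantOutside f M
embedding-constant-outside zero {n} f _ _ = ∅ , ≤-reflexive (∣⊥∣≡0 n) , λ { [] [] _ → refl }
embedding-constant-outside (suc k) f f-injective f-adj =
  let (d , rungs)                   = rung-direction-constant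
      (M₀ , ∣M₀∣≤k , f₀-constant) = embedding-constant-outside k f₀ f₀-injective f₀-adj
  in ⁅ d ⁆ ∪ M₀ , ≤-trans (∣⁅x⁆∪p∣≤1+∣p∣ d M₀) (s≤s ∣M₀∣≤k) , constant-outside-∪ rungs f₀-constant
  where open Layers f f-injective f-adj

Between : ∀ {n} → Vertex n → Vertex n → Vertex n → Set
Between u v w = ∀ i → lookup w i ≡ lookup u i ⊎ lookup w i ≡ lookup v i

Between-flip : ∀ {n} (i : Fin n) (u v w : Vertex n) → lookup u i ≢ lookup v i →
               Between (flip i u) v w → Between u v w
Between-flip i u v w ne between j with i Fin.≟ j | between j
... | _        | inj₂ wv = inj₂ wv
... | yes refl | inj₁ wu = inj₂ (trans wu (lookup-flip-≢ u ne))
... | no i≢j   | inj₁ wu = inj₁ (trans wu (lookup∘updateAt′ j i (≢-sym i≢j) u))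

FaultFree : ∀ {n m t} → Family n m t → Fin n → Bool → Set
FaultFree F j γ = ∀ w → lookup w j ≡ γ → Alive F w

module _ {n m t} {F : Family n m t} where

  source-alive : ∀ {u v l} → Path F u v l → Alive F u
  source-alive (here a)     = a
  source-alive (step a _ _) = a

  snoc : ∀ {u w v l} → Path F u w l → Adj w v → Alive F v → Path F u v (suc l)
  snoc (here a)     adj av = step a adj (here av)
  snoc (step a e p) adj av = step a e (snoc p adj av)

  reverse : ∀ {u v l} → Path F u v l → Path F v u l
  reverse (here a)             = here a
  reverse (step {u} {w} a e p) = snoc (reverse p) (Adj-sym u w e) a

  path-invariant : ∀ {A : Set} (g : Vertex n → A) →
                   (∀ {u w} → Alive F u → Alive F w → Adj u w → g u ≡ g w) →
                   ∀ {u v l} → Path F u v l → g u ≡ g v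
  path-invariant g inv (here _)     = refl
  path-invariant g inv (step a e p) = trans (inv a (source-alive p) e) (path-invariant g inv p)

  hamming≤length : ∀ {u v l} → Path F u v l → hamming u v ≤ l
  hamming≤length {u}     (here _)             = ≤-reflexive (hamming-refl u)
  hamming≤length {u} {v} (step {w = w} _ e p) with Adj⇒flip u w e
  ... | i , refl = ≤-trans (hamming≤1+hamming-flip i u v) (s≤s (hamming≤length p))

  geodesic : ∀ {u v} → (∀ w → Between u v w → Alive F w) → Path F u v (hamming u v)
  geodesic alive = walk _ refl alive
    where
    walk : ∀ d {u v} → hamming u v ≡ d → (∀ w → Between u v w → Alive F w) → Path F u v d
    walk zero    {u} {v} h alive =
      subst (λ v → Path F u v 0) (hamming≡0⇒≡ u v h) (here (alive u (λ _ → inj₁ refl)))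
    walk (suc d) {u} {v} h alive with hamming-suc⇒differ u v h
    ... | i , ne = step (alive u (λ _ → inj₁ refl)) (Adj-flip u i)
                        (walk d (suc-injective (trans (hamming-flip-differ i u v ne) h))
                              (λ w → alive w ∘ Between-flip i u v w ne))

  distance-hamming : ∀ {u v} → (∀ w → Between u v w → Alive F w) → DistIs F u v (hamming u v)
  distance-hamming alive = geodesic alive , λ l l<d p → ≤⇒≯ (hamming≤length p) l<d

module HalfCubePaths {n m t} {F : Family n m t} {j : Fin n} {γ : Bool} (free : FaultFree F j γ)
  where

  inside-path : ∀ {u v} → lookup u j ≡ γ → lookup v j ≡ γ → Path F u v (hamming u v)
  inside-path {u} {v} uj vj = geodesic λ w between → free w (side w (between j))
    where
    side : ∀ w → lookup w j ≡ lookup u j ⊎ lookup w j ≡ lookup v j → lookup w j ≡ γ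
    side w (inj₁ wu) = trans wu uj
    side w (inj₂ wv) = trans wv vj

  entering-path : ∀ {u v} → Alive F u → lookup u j ≢ γ → lookup v j ≡ γ → Path F u v (hamming u v)
  entering-path {u} {v} au uj vj =
    subst (Path F u v) (hamming-flip-differ j u v (λ uv → uj (trans uv vj)))
          (step au (Adj-flip u j) (inside-path (lookup-flip-≢ u uj) vj))

  leaving-path : ∀ {u v} → Alive F v → lookup u j ≡ γ → lookup v j ≢ γ → Path F u v (hamming u v)
  leaving-path {u} {v} av uj vj =
    subst (Path F u v) (hamming-comm v u) (reverse (entering-path av vj uj))

  touching-path : ∀ {u v} → Alive F u → Alive F v → lookup u j ≡ γ ⊎ lookup v j ≡ γ →
                  Path F u v (hamming u v)
  touching-path {u} {v} au av touches with lookup u j Bool.≟ γ | lookup v j Bool.≟ γ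
  ... | yes uj | yes vj = inside-path uj vj
  ... | yes uj | no  vj = leaving-path av uj vj
  ... | no  uj | yes vj = entering-path au uj vj
  ... | no  uj | no  vj = ⊥-elim ([ uj , vj ] touches)

  detour-path : ∀ {u v} → Alive F u → Alive F v → lookup u j ≢ γ → lookup v j ≢ γ →
                Path F u v (2 + hamming u v)
  detour-path {u} {v} au av uj vj =
    subst (Path F u v ∘ suc) (hamming-flip-agree j u v (trans (¬-not uj) (sym (¬-not vj))))
          (step au (Adj-flip u j) (leaving-path av (lookup-flip-≢ u uj) vj))

record FaultFreeHalfCubePair {n m t} (F : Family n m t) : Set where
  field
    p q   : Fin n
    α β   : Bool
    p≢q   : p ≢ q
    p-free : FaultFree F p α
    q-free : FaultFree F q β

module _ {n m t} {F : Family n m t} (H : FaultFreeHalfCubePair F) where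
  open FaultFreeHalfCubePair H

  diameter≤n : ∀ {u v} → Alive F u → Alive F v → ∃ λ l → l ≤ n × Path F u v l
  diameter≤n {u} {v} au av
    with (lookup u p Bool.≟ α) ⊎-dec (lookup v p Bool.≟ α)
       | (lookup u q Bool.≟ β) ⊎-dec (lookup v q Bool.≟ β)
  ... | yes touches-p | _ =
    _ , hamming≤n u v , HalfCubePaths.touching-path p-free au av touches-p
  ... | no _ | yes touches-q =
    _ , hamming≤n u v , HalfCubePaths.touching-path q-free au av touches-q
  ... | no misses-p | no misses-q =
    _ , agree-at-two⇒2+hamming≤n u v p≢q (agree misses-p) (agree misses-q) ,
    HalfCubePaths.detour-path p-free au av (misses-p ∘ inj₁) (misses-p ∘ inj₂)
    where
    agree : ∀ {i b} → ¬ (lookup u i ≡ b ⊎ lookup v i ≡ b) → lookup u i ≡ lookup v i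
    agree misses = trans (¬-not (misses ∘ inj₁)) (sym (¬-not (misses ∘ inj₂)))

Fixes : ∀ {n m} → Subcube n m → Fin n → Bool → Set
Fixes C i b = ∀ w → w ∈C C → lookup w i ≡ b

subcube-fixes-two-coordinates : ∀ {n m} → 2 + m ≤ n → (C : Subcube n m) →
                                ∃₂ λ p q → p ≢ q × ∃₂ λ α β → Fixes C p α × Fixes C q β
subcube-fixes-two-coordinates le C
  with embedding-constant-outside (dim C) (emb C) (inj C) (λ x y → Equivalence.from (adjIff C x y))
... | M , ∣M∣≤dim , constant
  with 2+∣p∣≤n⇒∃₂∉ M (≤-trans (+-monoʳ-≤ 2 (≤-trans ∣M∣≤dim (dim≤m C))) le)
... | p , q , p≢q , p∉M , q∉M = p , q , p≢q , _ , _ , fixed p∉M , fixed q∉M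
  where
  fixed : ∀ {i} → i ∉ M → Fixes C i (lookup (emb C (replicate _ false)) i)
  fixed i∉M w (x , refl) = constant x _ i∉M

fewer-than-two-faults⇒half-cubes : ∀ {n m t} → 2 + m ≤ n → t < 2 → (F : Family n m t) →
                                   FaultFreeHalfCubePair F
fewer-than-two-faults⇒half-cubes {t = 0} (s≤s (s≤s _)) _ F = record
  { p = zero ; q = suc zero ; α = false ; β = false ; p≢q = λ ()
  ; p-free = λ { _ _ (() , _) } ; q-free = λ { _ _ (() , _) } }
fewer-than-two-faults⇒half-cubes {t = 1} le _ F with subcube-fixes-two-coordinates le (cube F zero)
... | p , q , p≢q , α , β , p-fixed , q-fixed = record
  { p = p ; q = q ; α = not α ; β = not β ; p≢q = p≢q
  ; p-free = avoids p-fixed ; q-free = avoids q-fixed }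
  where
  avoids : ∀ {i b} → Fixes (cube F zero) i b → FaultFree F i (not b)
  avoids fixed w wi (zero , w∈C) = not-¬ (fixed w w∈C) wi
fewer-than-two-faults⇒half-cubes {t = suc (suc _)} _ (s≤s (s≤s ()))

fewer-than-two-faults⇒connected : ∀ {n m t} → 2 + m ≤ n → t < 2 → (F : Family n m t) →
                                  ¬ Disconnects F
fewer-than-two-faults⇒connected le t<2 F (u , v , au , av , no-path)
  with diameter≤n (fewer-than-two-faults⇒half-cubes le t<2 F) au av
... | l , _ , path = no-path l path

hamming-++ : ∀ {j k} (w : Vertex j) (x y : Vertex k) → hamming (w ++ x) (w ++ y) ≡ hamming x y
hamming-++ []      x y = refl
hamming-++ (b ∷ w) x y rewrite xor-same b = hamming-++ w x y

layer : ∀ {j} m → Vertex j → Subcube (j + m) m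
layer m w = record
  { dim = m ; dim≤m = ≤-refl ; emb = w ++_ ; inj = ++-injectiveʳ w w
  ; adjIff = λ x y → mk⇔ (trans (sym (hamming-++ w x y))) (trans (hamming-++ w x y)) }

diagonal-layer : ∀ m → Fin 2 → Subcube (2 + m) m
diagonal-layer m zero       = layer m (false ∷ false ∷ [])
diagonal-layer m (suc zero) = layer m (true ∷ true ∷ [])

diagonal-cut : ∀ m → Family (2 + m) m 2
diagonal-cut m = record { cube = diagonal-layer m ; disjoint = disjoint′ }
  where
  disjoint′ : ∀ i j → i ≢ j → ∀ v → v ∈C diagonal-layer m i → v ∈C diagonal-layer m j → ⊥
  disjoint′ zero       zero       i≢j _ _         _        = i≢j refl
  disjoint′ (suc zero) (suc zero) i≢j _ _         _        = i≢j refl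
  disjoint′ zero       (suc zero) _   _ (_ , refl) (_ , ())
  disjoint′ (suc zero) zero       _   _ (_ , refl) (_ , ())

diagonal-survivor : ∀ {m a b} (r : Vertex m) → Alive (diagonal-cut m) (a ∷ b ∷ r) → b ≡ not a
diagonal-survivor {a = false} {false} r alive = ⊥-elim (alive (zero , r , refl))
diagonal-survivor {a = true}  {true}  r alive = ⊥-elim (alive (suc zero , r , refl))
diagonal-survivor {a = false} {true}  _ _     = refl
diagonal-survivor {a = true}  {false} _ _     = refl

diagonal-cut-edge-keeps-head : ∀ {m} {u w : Vertex (2 + m)} → Alive (diagonal-cut m) u →
                               Alive (diagonal-cut m) w → Adj u w → head u ≡ head w
diagonal-cut-edge-keeps-head {u = a ∷ b ∷ r} {a′ ∷ b′ ∷ r′} au aw adj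
  with diagonal-survivor r au | diagonal-survivor r′ aw
... | refl | refl = same-head a a′ adj
  where
  same-head : ∀ a a′ → Adj (a ∷ not a ∷ r) (a′ ∷ not a′ ∷ r′) → a ≡ a′
  same-head false false _ = refl
  same-head true  true  _ = refl
  same-head false true  ()
  same-head true  false ()

diagonal-cut-disconnects : ∀ m → Disconnects (diagonal-cut m)
diagonal-cut-disconnects m =
  false ∷ true ∷ replicate m false , true ∷ false ∷ replicate m false ,
  (λ { (zero , _ , ()) ; (suc zero , _ , ()) }) , (λ { (zero , _ , ()) ; (suc zero , _ , ()) }) ,
  λ l path → contradiction (path-invariant head diagonal-cut-edge-keeps-head path) λ ()

no-faults : ∀ {n m} → Family n m 0
no-faults = record { cube = λ () ; disjoint = λ () }

hamming-antipodal : ∀ n → hamming (replicate n false) (replicate n true) ≡ n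
hamming-antipodal zero    = refl
hamming-antipodal (suc n) = cong suc (hamming-antipodal n)

antipodal-distance : ∀ {n m} → DistIs (no-faults {n} {m}) (replicate n false) (replicate n true) n
antipodal-distance {n} =
  subst (DistIs no-faults _ _) (hamming-antipodal n) (distance-hamming λ _ _ ())

theorem4p1 : (m : ℕ) → Σ ℕ λ κ →
    IsSubcubeConnectivity (m + 2) m κ × FaultDiameterIs (m + 2) m κ (m + 2)
theorem4p1 m rewrite +-comm m 2 =
  2 ,
  ((diagonal-cut m , diagonal-cut-disconnects m) ,
   λ t t<2 F → fewer-than-two-faults⇒connected ≤-refl t<2 F) ,
  (λ t t<2 F u v → diameter≤n (fewer-than-two-faults⇒half-cubes ≤-refl t<2 F)) ,
  (0 , s≤s z≤n , no-faults , replicate _ false , replicate _ true , (λ ()) , (λ ()) ,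
   antipodal-distance)
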